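{- Let $G=(V,E)$ be a finite undirected graph. The procedure $\mathrm{ExactLD}(G,\emptyset,V)$ visits all locally dense subsets of $V$; that is, every locally dense subset $W\subseteq V$ with $W\neq\emptyset$ and $W\neq V$ is output during the execution of $\mathrm{ExactLD}(G,\emptyset,V)$.
   Context: For $X\subseteq V$, $E(X)=\{(x,y)\in E: x,y\in X\}$. For disjoint $X,Y$, $E(X,Y)$ is the set of edges with one endpoint in $X$ and one in $Y$, $E_m(X,Y)=E(X)\cup E(X,Y)$, and for nonempty $X$ disjoint from $Y$, $d(X,Y)=|E_m(X,Y)|/|X|$; in general $d(X,Y)=d(X\setminus Y,Y)$. A set $W\subseteq V$ is locally dense if there do not exist a nonempty $X\subseteq W$ and a nonempty $Y\subseteq V$ with $Y\cap W=\emptyset$ such that $d(X,W\setminus X)\le d(Y,W)$. For real $\alpha$, $D(\alpha)$ is the maximizer of $|E(W)|-\alpha|W|$ over $W\subseteq V$, ties resolved by picking the largest maximizing $W$. The recursive procedure $\mathrm{ExactLD}(G,X,Y)$, called on locally dense sets $X\subsetneq Y$, does: set $\alpha\leftarrow d(Y,X)+|V|^{ -2}$; set $Z\leftarrow D(\alpha)$; if $Z\neq X$, then output $Z$, call $\mathrm{ExactLD}(G,X,Z)$, and call $\mathrm{ExactLD}(G,Z,Y)$. (Both $\emptyset$ and $V$ are locally dense.) -}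

module Defs where

open import Data.Bool using (Bool; true; false; _∧_; _∨_; if_then_else_)
open import Data.Nat as ℕ using (ℕ; zero; suc)
open import Data.Fin using (Fin; toℕ)
open import Data.Fin.Subset using (Subset; _∈_; _∉_; _⊆_; _⊂_; _─_; ∣_∣; Nonempty; ⊥; ⊤)
open import Data.Integer using (+_)
open import Data.Rational using (ℚ; _/_; 0ℚ; _+_; _-_; _*_; _≤_)
open import Data.List using (List; map; allFin; concatMap)
open import Data.Nat.ListAction using (sum)
open import Data.Vec using (lookup)
open import Data.Product using (_×_)
open import Relation.Nullary using (¬_)
open import Relation.Binary.PropositionalEquality using (_≡_; _≢_)

record Graph (n : ℕ) : Set where
  field
    adj   : Fin n → Fin n → Bool
    sym   : ∀ i j → adj i j ≡ adj j i
    irref : ∀ i → adj i i ≡ false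
open Graph public

mem : ∀ {n} → Subset n → Fin n → Bool
mem p i = lookup p i

-- number of edges {i,j} (counted once, via toℕ i < toℕ j) satisfying P i j
countEdges : ∀ {n} → Graph n → (Fin n → Fin n → Bool) → ℕ
countEdges {n} G P =
  sum (concatMap (λ i → map (λ j →
        if (toℕ i ℕ.<ᵇ toℕ j) ∧ adj G i j ∧ P i j then 1 else 0) (allFin n)) (allFin n))

eIn : ∀ {n} → Graph n → Subset n → ℕ
eIn G X = countEdges G (λ i j → mem X i ∧ mem X j)

-- |E_m(X,Y)| = |E(X') ∪ E(X',Y)| where X' = X \ Y
eM : ∀ {n} → Graph n → Subset n → Subset n → ℕ
eM G X Y = countEdges G (λ i j →
  (mem X' i ∧ (mem X' j ∨ mem Y j)) ∨ (mem X' j ∧ mem Y i))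
  where X' = X ─ Y

-- a / b as a rational (only used with b ≠ 0; totalised to 0 at b = 0)
frac : ℕ → ℕ → ℚ
frac a zero    = 0ℚ
frac a (suc k) = + a / suc k

fromℕ : ℕ → ℚ
fromℕ a = + a / 1

dens : ∀ {n} → Graph n → Subset n → Subset n → ℚ
dens G X Y = frac (eM G X Y) ∣ X ─ Y ∣

LocallyDense : ∀ {n} → Graph n → Subset n → Set
LocallyDense {n} G W =
  ∀ (X Y : Subset n) → X ⊆ W → Nonempty X → Nonempty Y →
    (∀ {i} → i ∈ Y → i ∉ W) → ¬ (dens G X (W ─ X) ≤ dens G Y W)

obj : ∀ {n} → Graph n → ℚ → Subset n → ℚ
obj G α W = fromℕ (eIn G W) - α * fromℕ ∣ W ∣

IsD : ∀ {n} → Graph n → ℚ → Subset n → Set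
IsD {n} G α Z =
  (∀ (U : Subset n) → obj G α U ≤ obj G α Z) ×
  (∀ (U : Subset n) → obj G α U ≡ obj G α Z → ∣ U ∣ ℕ.≤ ∣ Z ∣)

alpha : ∀ {n} → Graph n → Subset n → Subset n → ℚ
alpha {n} G X Y = dens G Y X + frac 1 (n ℕ.* n)

-- Output G X Y W : W is output during the execution of ExactLD(G,X,Y)
-- (calls are only made on locally dense X ⊊ Y, the procedure's precondition)
data Output {n} (G : Graph n) : Subset n → Subset n → Subset n → Set where
  here  : ∀ {X Y Z} → LocallyDense G X → LocallyDense G Y → X ⊂ Y →
          IsD G (alpha G X Y) Z → Z ≢ X → Output G X Y Z
  left  : ∀ {X Y Z W} → LocallyDense G X → LocallyDense G Y → X ⊂ Y →
          IsD G (alpha G X Y) Z → Z ≢ X → Output G X Z W → Output G X Y W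
  right : ∀ {X Y Z W} → LocallyDense G X → LocallyDense G Y → X ⊂ Y →
          IsD G (alpha G X Y) Z → Z ≢ X → Output G Z Y W → Output G X Y W

-- Locally dense sets form a chain: if A and B were locally dense and incomparable, then
-- d(A ∪ B, A) < d(A, A ∩ B) ≤ d(A ∪ B, B) < d(B, A ∩ B) ≤ d(A ∪ B, A).
-- A maximiser Z = D(α) is itself locally dense: removing a nonempty X ⊆ Z cannot increase
-- |E(·)| − α|·|, so d(X, Z ∖ X) ≥ α, and adding a nonempty Y outside Z must decrease it,
-- since Z is a largest maximiser, so d(Y, Z) < α.
-- Now let X ⊂ W ⊂ Y be locally dense and α = d(Y, X) + 1/n². Two distinct densities with
-- denominators q, s ≤ n differ by at least 1/(qs) ≥ 1/n², so every density above d(Y, X) is ≥ α.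
-- This rules out Y ⊆ Z and Z ⊆ X (for Z = X because d(Y, X) is the mediant of d(Y, W) < d(W, X)),
-- hence X ⊂ Z ⊂ Y by the chain property. As W is comparable with Z, either W = Z is output or W
-- lies strictly inside one of the two recursive calls, and we induct on |Y| − |X|.
module Submission where

open import Defs hiding (sym)
open import Data.Nat using (ℕ; zero; suc; _+_; _*_; _∸_; _≤_; _<_; _<ᵇ_; z≤n; NonZero)
import Data.Nat.Properties as ℕ
open import Data.Nat.Induction using (<-wellFounded)
open import Data.Nat.ListAction using (sum)
open import Data.Nat.ListAction.Properties using (sum-++)
open import Data.Nat.Tactic.RingSolver using (solve-∀)
open import Algebra.Properties.CommutativeSemigroup ℕ.+-commutativeSemigroup using (interchange)
open import Data.Integer as ℤ using (+_)
import Data.Integer.Properties as ℤ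
open import Data.Integer.Tactic.RingSolver using () renaming (solve-∀ to ℤ-solve-∀)
open import Data.Rational as ℚ using (ℚ; toℚᵘ)
import Data.Rational.Properties as ℚ
open import Data.Rational.Solver using (module +-*-Solver)
open import Data.Rational.Unnormalised as ℚᵘ using (mkℚᵘ; *≡*; *≤*; *<*)
import Data.Rational.Unnormalised.Properties as ℚᵘ
open import Data.Bool as Bool using (Bool; true; false; _∧_; _∨_; not; if_then_else_; b≤b; f≤t)
import Data.Bool.Properties as Bool
open import Data.Fin using (Fin; toℕ) renaming (zero to fzero; suc to fsuc)
open import Data.Fin.Properties using (nonZeroIndex)
open import Data.Fin.Subset
open import Data.Fin.Subset.Properties
open import Data.Vec using (_∷_; []; here)
open import Data.Vec.Properties using ([]=⇒lookup; lookup⇒[]=)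
open import Data.List as List using (List; map; _++_; concatMap; allFin)
import Data.List.Membership.Propositional as List
open import Data.List.Membership.Propositional.Properties using (∈-++⁺ˡ; ∈-++⁺ʳ; ∈-map⁺)
import Data.List.Relation.Unary.Any as Any
import Data.List.Relation.Unary.All as All
open import Data.Product using (_×_; _,_; proj₁; proj₂; ∃)
open import Data.Product.Relation.Binary.Lex.NonStrict using (×-totalOrder; ×-Lex)
open import Data.List.Extrema (×-totalOrder ℚ.≤-decTotalOrder ℕ.≤-totalOrder) using (argmax; f[xs]≤f[argmax])
open import Data.Empty using (⊥-elim)
open import Data.Sum using (_⊎_; inj₁; inj₂; [_,_]′)
open import Function using (_∘_)
open import Induction.WellFounded using (Acc; acc)
open import Relation.Nullary using (¬_; yes; no; contradiction)
open import Relation.Binary.PropositionalEquality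
  using (_≡_; _≢_; refl; sym; trans; cong; cong₂; subst; subst₂; module ≡-Reasoning)

private variable
  A : Set
  n : ℕ

-- Fractions a / k

toℚᵘ-frac : ∀ a k → toℚᵘ (frac a (suc k)) ℚᵘ.≃ mkℚᵘ (+ a) k
toℚᵘ-frac a k = ℚ.toℚᵘ-fromℚᵘ (mkℚᵘ (+ a) k)

*≤⇒frac≤ : ∀ {a b} k l .{{_ : NonZero k}} .{{_ : NonZero l}} →
           a * l ≤ b * k → frac a k ℚ.≤ frac b l
*≤⇒frac≤ {a} {b} (suc k) (suc l) al≤bk = ℚ.toℚᵘ-cancel-≤
  (ℚᵘ.≤-respˡ-≃ (ℚᵘ.≃-sym (toℚᵘ-frac a k)) (ℚᵘ.≤-respʳ-≃ (ℚᵘ.≃-sym (toℚᵘ-frac b l))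
    (*≤* (subst₂ ℤ._≤_ (ℤ.pos-* a (suc l)) (ℤ.pos-* b (suc k)) (ℤ.+≤+ al≤bk)))))

*<⇒frac< : ∀ {a b} k l .{{_ : NonZero k}} .{{_ : NonZero l}} →
           a * l < b * k → frac a k ℚ.< frac b l
*<⇒frac< {a} {b} (suc k) (suc l) al<bk = ℚ.toℚᵘ-cancel-<
  (ℚᵘ.<-respˡ-≃ (ℚᵘ.≃-sym (toℚᵘ-frac a k)) (ℚᵘ.<-respʳ-≃ (ℚᵘ.≃-sym (toℚᵘ-frac b l))
    (*<* (subst₂ ℤ._<_ (ℤ.pos-* a (suc l)) (ℤ.pos-* b (suc k)) (ℤ.+<+ al<bk)))))

frac<⇒*< : ∀ {a b} k l .{{_ : NonZero k}} .{{_ : NonZero l}} →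
           frac a k ℚ.< frac b l → a * l < b * k
frac<⇒*< {a} {b} (suc k) (suc l) lt = ℤ.drop‿+<+
  (subst₂ ℤ._<_ (sym (ℤ.pos-* a (suc l))) (sym (ℤ.pos-* b (suc k)))
    (ℚᵘ.drop-*<* (ℚᵘ.<-respˡ-≃ (toℚᵘ-frac a k) (ℚᵘ.<-respʳ-≃ (toℚᵘ-frac b l) (ℚ.toℚᵘ-mono-< lt)))))

frac-monoˡ-≤ : ∀ {a b} k → a ≤ b → frac a k ℚ.≤ frac b k
frac-monoˡ-≤         zero      _   = ℚ.≤-refl
frac-monoˡ-≤ {a} {b} k@(suc _) a≤b = *≤⇒frac≤ {a} {b} k k (ℕ.*-monoˡ-≤ k a≤b)

fromℕ-+ : ∀ a b → fromℕ (a + b) ≡ fromℕ a ℚ.+ fromℕ b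
fromℕ-+ a b = ℚ.toℚᵘ-injective (begin-equality
  toℚᵘ (fromℕ (a + b))                  ≃⟨ toℚᵘ-frac (a + b) 0 ⟩
  mkℚᵘ (+ (a + b)) 0                     ≃⟨ *≡* (trans (cong (ℤ._* + 1) (ℤ.pos-+ a b)) (over-1 (+ a) (+ b))) ⟩
  mkℚᵘ (+ a) 0 ℚᵘ.+ mkℚᵘ (+ b) 0        ≃⟨ ℚᵘ.+-cong (toℚᵘ-frac a 0) (toℚᵘ-frac b 0) ⟨
  toℚᵘ (fromℕ a) ℚᵘ.+ toℚᵘ (fromℕ b)    ≃⟨ ℚ.toℚᵘ-homo-+ (fromℕ a) (fromℕ b) ⟨
  toℚᵘ (fromℕ a ℚ.+ fromℕ b)            ∎)
  where
  open ℚᵘ.≤-Reasoning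
  over-1 : ∀ x y → (x ℤ.+ y) ℤ.* + 1 ≡ (x ℤ.* + 1 ℤ.+ y ℤ.* + 1) ℤ.* + 1
  over-1 = ℤ-solve-∀

frac-+ : ∀ a b k l .{{_ : NonZero k}} .{{_ : NonZero l}} →
         frac a k ℚ.+ frac b l ≡ frac (a * l + b * k) (k * l)
frac-+ a b k@(suc k-1) l@(suc l-1) = ℚ.toℚᵘ-injective (begin-equality
  toℚᵘ (frac a k ℚ.+ frac b l)              ≃⟨ ℚ.toℚᵘ-homo-+ (frac a k) (frac b l) ⟩
  toℚᵘ (frac a k) ℚᵘ.+ toℚᵘ (frac b l)      ≃⟨ ℚᵘ.+-cong (toℚᵘ-frac a k-1) (toℚᵘ-frac b l-1) ⟩
  mkℚᵘ (+ a) k-1 ℚᵘ.+ mkℚᵘ (+ b) l-1        ≃⟨ ℚᵘ.≃-reflexive (cong (λ z → mkℚᵘ z (l-1 + k-1 * l)) numerator) ⟩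
  mkℚᵘ (+ (a * l + b * k)) (l-1 + k-1 * l)  ≃⟨ toℚᵘ-frac (a * l + b * k) (l-1 + k-1 * l) ⟨
  toℚᵘ (frac (a * l + b * k) (k * l))       ∎)
  where
  open ℚᵘ.≤-Reasoning
  numerator : + a ℤ.* + l ℤ.+ + b ℤ.* + k ≡ + (a * l + b * k)
  numerator = sym (trans (ℤ.pos-+ (a * l) (b * k)) (cong₂ ℤ._+_ (ℤ.pos-* a l) (ℤ.pos-* b k)))

frac-*-fromℕ : ∀ a k .{{_ : NonZero k}} → frac a k ℚ.* fromℕ k ≡ fromℕ a
frac-*-fromℕ a k@(suc k-1) = ℚ.toℚᵘ-injective (begin-equality
  toℚᵘ (frac a k ℚ.* fromℕ k)            ≃⟨ ℚ.toℚᵘ-homo-* (frac a k) (fromℕ k) ⟩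
  toℚᵘ (frac a k) ℚᵘ.* toℚᵘ (fromℕ k)    ≃⟨ ℚᵘ.*-cong (toℚᵘ-frac a k-1) (toℚᵘ-frac k 0) ⟩
  mkℚᵘ (+ a) k-1 ℚᵘ.* mkℚᵘ (+ k) 0       ≃⟨ *≡* cancel ⟩
  mkℚᵘ (+ a) 0                           ≃⟨ toℚᵘ-frac a 0 ⟨
  toℚᵘ (fromℕ a)                         ∎)
  where
  open ℚᵘ.≤-Reasoning
  cancel : (+ a ℤ.* + k) ℤ.* + 1 ≡ + a ℤ.* + suc (k-1 * 1)
  cancel rewrite ℕ.*-identityʳ k-1 = ℤ.*-identityʳ (+ a ℤ.* + k)

fromℕ-pos : ∀ k .{{_ : NonZero k}} → ℚ.Positive (fromℕ k)
fromℕ-pos (suc k) = ℚ.normalize-pos (suc k) 1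

frac<⇒fromℕ<* : ∀ {a} α k .{{_ : NonZero k}} → frac a k ℚ.< α → fromℕ a ℚ.< α ℚ.* fromℕ k
frac<⇒fromℕ<* {a} α k lt =
  subst (ℚ._< α ℚ.* fromℕ k) (frac-*-fromℕ a k) (ℚ.*-monoˡ-<-pos (fromℕ k) {{fromℕ-pos k}} lt)

≤frac⇒*fromℕ≤ : ∀ {a} α k .{{_ : NonZero k}} → α ℚ.≤ frac a k → α ℚ.* fromℕ k ℚ.≤ fromℕ a
≤frac⇒*fromℕ≤ {a} α k le = subst (α ℚ.* fromℕ k ℚ.≤_) (frac-*-fromℕ a k)
  (ℚ.*-monoʳ-≤-nonNeg (fromℕ k) {{ℚ.pos⇒nonNeg (fromℕ k) {{fromℕ-pos k}}}} le)

frac-gap : ∀ {a b} k l N .{{_ : NonZero k}} .{{_ : NonZero l}} →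
           k * l ≤ N → frac a k ℚ.< frac b l → frac a k ℚ.+ frac 1 N ℚ.≤ frac b l
frac-gap {a} {b} k@(suc _) l@(suc _) N@(suc _) kl≤N lt =
  subst (ℚ._≤ frac b l) (sym (frac-+ a 1 k N)) (*≤⇒frac≤ {a * N + 1 * k} {b} (k * N) l cross)
  where
  open ℕ.≤-Reasoning
  expand : ∀ a N k l → (a * N + 1 * k) * l ≡ a * l * N + k * l
  expand = solve-∀
  cross : (a * N + 1 * k) * l ≤ b * (k * N)
  cross = begin
    (a * N + 1 * k) * l  ≡⟨ expand a N k l ⟩
    a * l * N + k * l    ≤⟨ ℕ.+-monoʳ-≤ (a * l * N) kl≤N ⟩
    a * l * N + N        ≡⟨ ℕ.+-comm (a * l * N) N ⟩
    suc (a * l) * N      ≤⟨ ℕ.*-monoˡ-≤ N (frac<⇒*< {a} {b} k l lt) ⟩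
    b * k * N            ≡⟨ ℕ.*-assoc b k N ⟩
    b * (k * N)          ∎

frac-mediant-< : ∀ {a b} c d .{{_ : NonZero c}} .{{_ : NonZero d}} →
                 frac b d ℚ.< frac a c → frac (a + b) (c + d) ℚ.< frac a c
frac-mediant-< {a} {b} c@(suc _) d@(suc _) lt = *<⇒frac< {a + b} {a} (c + d) c (begin-strict
  (a + b) * c      ≡⟨ ℕ.*-distribʳ-+ c a b ⟩
  a * c + b * c    <⟨ ℕ.+-monoʳ-< (a * c) (frac<⇒*< {b} {a} d c lt) ⟩
  a * c + a * d    ≡⟨ ℕ.*-distribˡ-+ a c d ⟨
  a * (c + d)      ∎)
  where open ℕ.≤-Reasoning

p<q⇒r+[p-q]<r : ∀ {p q} r → p ℚ.< q → r ℚ.+ (p ℚ.- q) ℚ.< r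
p<q⇒r+[p-q]<r {p} {q} r p<q = begin-strict
  r ℚ.+ (p ℚ.- q)  <⟨ ℚ.+-monoʳ-< r (ℚ.+-monoˡ-< (ℚ.- q) p<q) ⟩
  r ℚ.+ (q ℚ.- q)  ≡⟨ cong (r ℚ.+_) (ℚ.+-inverseʳ q) ⟩
  r ℚ.+ ℚ.0ℚ       ≡⟨ ℚ.+-identityʳ r ⟩
  r                ∎
  where open ℚ.≤-Reasoning

p≤q⇒r≤r+[q-p] : ∀ {p q} r → p ℚ.≤ q → r ℚ.≤ r ℚ.+ (q ℚ.- p)
p≤q⇒r≤r+[q-p] {p} {q} r p≤q = begin
  r                ≡⟨ ℚ.+-identityʳ r ⟨
  r ℚ.+ ℚ.0ℚ       ≡⟨ cong (r ℚ.+_) (ℚ.+-inverseʳ p) ⟨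
  r ℚ.+ (p ℚ.- p)  ≤⟨ ℚ.+-monoʳ-≤ r (ℚ.+-monoˡ-≤ (ℚ.- p) p≤q) ⟩
  r ℚ.+ (q ℚ.- p)  ∎
  where open ℚ.≤-Reasoning

p<p+1/N : ∀ p N .{{_ : NonZero N}} → p ℚ.< p ℚ.+ frac 1 N
p<p+1/N p N@(suc _) = begin-strict
  p               ≡⟨ ℚ.+-identityʳ p ⟨
  p ℚ.+ ℚ.0ℚ      <⟨ ℚ.+-monoʳ-< p (ℚ.positive⁻¹ (frac 1 N) {{ℚ.normalize-pos 1 N}}) ⟩
  p ℚ.+ frac 1 N  ∎
  where open ℚ.≤-Reasoning

-- Subsets of Fin n

mem-─ : ∀ (p q : Subset n) i → mem (p ─ q) i ≡ mem p i ∧ not (mem q i)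
mem-─ (x ∷ p) (true  ∷ q) fzero    = sym (Bool.∧-zeroʳ x)
mem-─ (x ∷ p) (false ∷ q) fzero    = sym (Bool.∧-identityʳ x)
mem-─ (x ∷ p) (y ∷ q)     (fsuc i) = mem-─ p q i

⊆⇒mem≤ : ∀ {p q : Subset n} → p ⊆ q → ∀ i → mem p i Bool.≤ mem q i
⊆⇒mem≤ {p = p} {q} p⊆q i with mem p i in eq
... | false = Bool.≤-minimum (mem q i)
... | true  = Bool.≤-reflexive (sym ([]=⇒lookup (p⊆q (lookup⇒[]= i p eq))))

x∈p─q⇒x∉q : ∀ {p q : Subset n} {x} → x ∈ p ─ q → x ∉ q
x∈p─q⇒x∉q {p = _ ∷ p} {true  ∷ q} {fzero}  ()
x∈p─q⇒x∉q {p = _ ∷ p} {false ∷ q} {fzero}  _  ()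
x∈p─q⇒x∉q {p = _ ∷ p} {_ ∷ q}     {fsuc x} x∈ x∈q = x∈p─q⇒x∉q (drop-there x∈) (drop-there x∈q)

Empty[p─q]⇒p⊆q : ∀ {p q : Subset n} → Empty (p ─ q) → p ⊆ q
Empty[p─q]⇒p⊆q {q = q} empty {x} x∈p with x ∈? q
... | yes x∈q = x∈q
... | no  x∉q = contradiction (x , x∈p∧x∉q⇒x∈p─q x∈p x∉q) empty

⊈⇒∃∉ : ∀ {p q : Subset n} → ¬ p ⊆ q → ∃ λ x → x ∈ p × x ∉ q
⊈⇒∃∉ {p = p} {q} p⊈q with nonempty? (p ─ q)
... | yes (x , x∈p─q) = x , p─q⊆p p q x∈p─q , x∈p─q⇒x∉q x∈p─q
... | no  empty       = contradiction (λ {x} → Empty[p─q]⇒p⊆q empty {x}) p⊈q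

p⊆q∧q⊈p⇒p⊂q : ∀ {p q : Subset n} → p ⊆ q → ¬ q ⊆ p → p ⊂ q
p⊆q∧q⊈p⇒p⊂q p⊆q q⊈p = p⊆q , ⊈⇒∃∉ q⊈p

⊆⇒⊂⊎≡ : ∀ {p q : Subset n} → p ⊆ q → p ⊂ q ⊎ p ≡ q
⊆⇒⊂⊎≡ {p = p} {q} p⊆q with q ⊆? p
... | yes q⊆p = inj₂ (⊆-antisym p⊆q q⊆p)
... | no  q⊈p = inj₁ (p⊆q∧q⊈p⇒p⊂q p⊆q q⊈p)

⊂⇒Nonempty─ : ∀ {p q : Subset n} → p ⊂ q → Nonempty (q ─ p)
⊂⇒Nonempty─ (_ , x , x∈q , x∉p) = x , x∈p∧x∉q⇒x∈p─q x∈q x∉p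

Nonempty⇒NonZero : ∀ {p : Subset n} → Nonempty p → NonZero ∣ p ∣
Nonempty⇒NonZero {p = true  ∷ p} _              = _
Nonempty⇒NonZero {p = false ∷ p} (fsuc x , x∈p) = Nonempty⇒NonZero (x , drop-there x∈p)

∣q─p∣-nonZero : ∀ {p q : Subset n} → p ⊂ q → NonZero ∣ q ─ p ∣
∣q─p∣-nonZero = Nonempty⇒NonZero ∘ ⊂⇒Nonempty─

p─[p─q]≡q : ∀ {p q : Subset n} → q ⊆ p → p ─ (p ─ q) ≡ q
p─[p─q]≡q {p = []}        {[]}        _   = refl
p─[p─q]≡q {p = true  ∷ p} {true  ∷ q} q⊆p = cong (true ∷_)  (p─[p─q]≡q (drop-∷-⊆ q⊆p))
p─[p─q]≡q {p = true  ∷ p} {false ∷ q} q⊆p = cong (false ∷_) (p─[p─q]≡q (drop-∷-⊆ q⊆p))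
p─[p─q]≡q {p = false ∷ p} {false ∷ q} q⊆p = cong (false ∷_) (p─[p─q]≡q (drop-∷-⊆ q⊆p))
p─[p─q]≡q {p = false ∷ p} {true  ∷ q} q⊆p with q⊆p here
... | ()

p─[q─p]≡p : ∀ (p q : Subset n) → p ─ (q ─ p) ≡ p
p─[q─p]≡p []          []          = refl
p─[q─p]≡p (true  ∷ p) (_     ∷ q) = cong (true ∷_)  (p─[q─p]≡p p q)
p─[q─p]≡p (false ∷ p) (true  ∷ q) = cong (false ∷_) (p─[q─p]≡p p q)
p─[q─p]≡p (false ∷ p) (false ∷ q) = cong (false ∷_) (p─[q─p]≡p p q)

[p∪q]─p≡q─p : ∀ (p q : Subset n) → (p ∪ q) ─ p ≡ q ─ p
[p∪q]─p≡q─p []          []      = refl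
[p∪q]─p≡q─p (true  ∷ p) (y ∷ q) = cong (false ∷_) ([p∪q]─p≡q─p p q)
[p∪q]─p≡q─p (false ∷ p) (y ∷ q) = cong (y ∷_)     ([p∪q]─p≡q─p p q)

p─[p∩q]≡p─q : ∀ (p q : Subset n) → p ─ (p ∩ q) ≡ p ─ q
p─[p∩q]≡p─q []          []          = refl
p─[p∩q]≡p─q (true  ∷ p) (true  ∷ q) = cong (false ∷_) (p─[p∩q]≡p─q p q)
p─[p∩q]≡p─q (true  ∷ p) (false ∷ q) = cong (true ∷_)  (p─[p∩q]≡p─q p q)
p─[p∩q]≡p─q (false ∷ p) (true  ∷ q) = cong (false ∷_) (p─[p∩q]≡p─q p q)
p─[p∩q]≡p─q (false ∷ p) (false ∷ q) = cong (false ∷_) (p─[p∩q]≡p─q p q)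

∣q∣≡∣p∣+∣q─p∣ : ∀ {p q : Subset n} → p ⊆ q → ∣ q ∣ ≡ ∣ p ∣ + ∣ q ─ p ∣
∣q∣≡∣p∣+∣q─p∣ {p = []}        {[]}        _   = refl
∣q∣≡∣p∣+∣q─p∣ {p = true  ∷ p} {true  ∷ q} p⊆q = cong suc (∣q∣≡∣p∣+∣q─p∣ (drop-∷-⊆ p⊆q))
∣q∣≡∣p∣+∣q─p∣ {p = false ∷ p} {true  ∷ q} p⊆q =
  trans (cong suc (∣q∣≡∣p∣+∣q─p∣ (drop-∷-⊆ p⊆q))) (sym (ℕ.+-suc ∣ p ∣ ∣ q ─ p ∣))
∣q∣≡∣p∣+∣q─p∣ {p = false ∷ p} {false ∷ q} p⊆q = ∣q∣≡∣p∣+∣q─p∣ (drop-∷-⊆ p⊆q)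
∣q∣≡∣p∣+∣q─p∣ {p = true  ∷ p} {false ∷ q} p⊆q with p⊆q here
... | ()

chain-additive : ∀ (h : Subset n → ℕ) (g : Subset n → Subset n → ℕ) →
                 (∀ {P Q} → P ⊆ Q → h Q ≡ h P + g Q P) →
                 ∀ {X W Y} → X ⊆ W → W ⊆ Y → g Y X ≡ g W X + g Y W
chain-additive h g split {X} {W} {Y} X⊆W W⊆Y = ℕ.+-cancelˡ-≡ (h X) _ _ (begin
  h X + g Y X            ≡⟨ split (⊆-trans X⊆W W⊆Y) ⟨
  h Y                    ≡⟨ split W⊆Y ⟩
  h W + g Y W            ≡⟨ cong (_+ g Y W) (split X⊆W) ⟩
  h X + g W X + g Y W    ≡⟨ ℕ.+-assoc (h X) (g W X) (g Y W) ⟩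
  h X + (g W X + g Y W)  ∎)
  where open ≡-Reasoning

allSubsets : ∀ n → List (Subset n)
allSubsets zero    = List.[ [] ]
allSubsets (suc n) = map (true ∷_) (allSubsets n) ++ map (false ∷_) (allSubsets n)

∈-allSubsets : ∀ (p : Subset n) → p List.∈ allSubsets n
∈-allSubsets         []          = Any.here refl
∈-allSubsets         (true  ∷ p) = ∈-++⁺ˡ (∈-map⁺ (true ∷_) (∈-allSubsets p))
∈-allSubsets {suc n} (false ∷ p) = ∈-++⁺ʳ (map (true ∷_) (allSubsets n)) (∈-map⁺ (false ∷_) (∈-allSubsets p))

-- Counting edges

sum-concatMap : ∀ (F : A → List ℕ) xs → sum (concatMap F xs) ≡ sum (map (sum ∘ F) xs)
sum-concatMap F List.[]    = refl
sum-concatMap F (x List.∷ xs) =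
  trans (sum-++ (F x) (concatMap F xs)) (cong (_+_ (sum (F x))) (sum-concatMap F xs))

sum-map-+ : ∀ {f g h : A → ℕ} → (∀ x → f x ≡ g x + h x) →
            ∀ xs → sum (map f xs) ≡ sum (map g xs) + sum (map h xs)
sum-map-+ f≡g+h List.[] = refl
sum-map-+ {g = g} {h} f≡g+h (x List.∷ xs) =
  trans (cong₂ _+_ (f≡g+h x) (sum-map-+ f≡g+h xs)) (interchange (g x) (h x) _ _)

sum-map-mono : ∀ {f g : A → ℕ} → (∀ x → f x ≤ g x) → ∀ xs → sum (map f xs) ≤ sum (map g xs)
sum-map-mono f≤g List.[]       = z≤n
sum-map-mono f≤g (x List.∷ xs) = ℕ.+-mono-≤ (f≤g x) (sum-map-mono f≤g xs)

indicator : Bool → ℕ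
indicator b = if b then 1 else 0

indicator-mono : ∀ {b c} → b Bool.≤ c → indicator b ≤ indicator c
indicator-mono f≤t = z≤n
indicator-mono b≤b = ℕ.≤-refl

indicator-∧-+ : ∀ a {b c d} → indicator b ≡ indicator c + indicator d →
                indicator (a ∧ b) ≡ indicator (a ∧ c) + indicator (a ∧ d)
indicator-∧-+ true  eq = eq
indicator-∧-+ false _  = refl

∧-mono-≤ : ∀ {a b c d} → a Bool.≤ b → c Bool.≤ d → a ∧ c Bool.≤ b ∧ d
∧-mono-≤ f≤t           _   = Bool.≤-minimum _
∧-mono-≤ (b≤b {false}) _   = b≤b
∧-mono-≤ (b≤b {true})  c≤d = c≤d

∨-mono-≤ : ∀ {a b c d} → a Bool.≤ b → c Bool.≤ d → a ∨ c Bool.≤ b ∨ d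
∨-mono-≤ f≤t           _   = Bool.≤-maximum _
∨-mono-≤ (b≤b {false}) c≤d = c≤d
∨-mono-≤ (b≤b {true})  _   = b≤b

-- For disjoint S and C, an edge ij lies in E_m(S, C) iff meets (i ∈ S) (j ∈ S) (i ∈ C) (j ∈ C).
meets : Bool → Bool → Bool → Bool → Bool
meets si sj ci cj = (si ∧ (sj ∨ cj)) ∨ (sj ∧ ci)

meets-monoʳ : ∀ si sj {ci cj ci′ cj′} → ci Bool.≤ ci′ → cj Bool.≤ cj′ →
              meets si sj ci cj Bool.≤ meets si sj ci′ cj′
meets-monoʳ si sj ci≤ cj≤ =
  ∨-mono-≤ (∧-mono-≤ (b≤b {si}) (∨-mono-≤ (b≤b {sj}) cj≤)) (∧-mono-≤ (b≤b {sj}) ci≤)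

indicator-split : ∀ {xi yi xj yj} → xi Bool.≤ yi → xj Bool.≤ yj →
  indicator (yi ∧ yj) ≡ indicator (xi ∧ xj) + indicator (meets (yi ∧ not xi) (yj ∧ not xj) xi xj)
indicator-split f≤t           f≤t           = refl
indicator-split f≤t           (b≤b {false}) = refl
indicator-split f≤t           (b≤b {true})  = refl
indicator-split (b≤b {false}) f≤t           = refl
indicator-split (b≤b {false}) (b≤b {false}) = refl
indicator-split (b≤b {false}) (b≤b {true})  = refl
indicator-split (b≤b {true})  f≤t           = refl
indicator-split (b≤b {true})  (b≤b {false}) = refl
indicator-split (b≤b {true})  (b≤b {true})  = refl

module _ (G : Graph n) where

  private
    term : (Fin n → Fin n → Bool) → Fin n → Fin n → ℕ
    term P i j = indicator ((toℕ i <ᵇ toℕ j) ∧ adj G i j ∧ P i j)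

    countEdges≡ΣΣ : ∀ P → countEdges G P ≡ sum (map (λ i → sum (map (term P i) (allFin n))) (allFin n))
    countEdges≡ΣΣ P = sum-concatMap (λ i → map (term P i) (allFin n)) (allFin n)

  countEdges-+ : ∀ {P Q R} → (∀ i j → indicator (P i j) ≡ indicator (Q i j) + indicator (R i j)) →
                 countEdges G P ≡ countEdges G Q + countEdges G R
  countEdges-+ {P} {Q} {R} split = begin
    countEdges G P
      ≡⟨ countEdges≡ΣΣ P ⟩
    sum (map (λ i → sum (map (term P i) (allFin n))) (allFin n))
      ≡⟨ sum-map-+ (λ i → sum-map-+ (λ j → term-split i j) (allFin n)) (allFin n) ⟩
    sum (map (λ i → sum (map (term Q i) (allFin n))) (allFin n)) +
    sum (map (λ i → sum (map (term R i) (allFin n))) (allFin n))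
      ≡⟨ cong₂ _+_ (countEdges≡ΣΣ Q) (countEdges≡ΣΣ R) ⟨
    countEdges G Q + countEdges G R ∎
    where
    open ≡-Reasoning
    term-split : ∀ i j → term P i j ≡ term Q i j + term R i j
    term-split i j = indicator-∧-+ (toℕ i <ᵇ toℕ j) (indicator-∧-+ (adj G i j) (split i j))

  countEdges-mono : ∀ {P Q} → (∀ i j → P i j Bool.≤ Q i j) → countEdges G P ≤ countEdges G Q
  countEdges-mono {P} {Q} P≤Q = subst₂ _≤_ (sym (countEdges≡ΣΣ P)) (sym (countEdges≡ΣΣ Q))
    (sum-map-mono (λ i → sum-map-mono (λ j → term-mono i j) (allFin n)) (allFin n))
    where
    term-mono : ∀ i j → term P i j ≤ term Q i j
    term-mono i j = indicator-mono (∧-mono-≤ (b≤b {toℕ i <ᵇ toℕ j}) (∧-mono-≤ (b≤b {adj G i j}) (P≤Q i j)))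

  -- eM G A C and dens G A C unfold to incident (A ─ C) C and frac (incident (A ─ C) C) ∣ A ─ C ∣.
  incident : Subset n → Subset n → ℕ
  incident S C = countEdges G (λ i j → meets (mem S i) (mem S j) (mem C i) (mem C j))

  incident-monoʳ : ∀ S {C C′} → C ⊆ C′ → incident S C ≤ incident S C′
  incident-monoʳ S C⊆C′ = countEdges-mono λ i j →
    meets-monoʳ (mem S i) (mem S j) (⊆⇒mem≤ C⊆C′ i) (⊆⇒mem≤ C⊆C′ j)

  eIn-split : ∀ {X Y} → X ⊆ Y → eIn G Y ≡ eIn G X + eM G Y X
  eIn-split {X} {Y} X⊆Y = countEdges-+ λ i j →
    subst₂ (λ si sj → indicator (mem Y i ∧ mem Y j) ≡
                      indicator (mem X i ∧ mem X j) + indicator (meets si sj (mem X i) (mem X j)))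
           (sym (mem-─ Y X i)) (sym (mem-─ Y X j))
           (indicator-split (⊆⇒mem≤ X⊆Y i) (⊆⇒mem≤ X⊆Y j))

  eM-split : ∀ {X W Y} → X ⊆ W → W ⊆ Y → eM G Y X ≡ eM G W X + eM G Y W
  eM-split = chain-additive (eIn G) (eM G) eIn-split

  -- Densities and the objective |E(W)| − α|W|

  ∣─∣-split : ∀ {X W Y : Subset n} → X ⊆ W → W ⊆ Y → ∣ Y ─ X ∣ ≡ ∣ W ─ X ∣ + ∣ Y ─ W ∣
  ∣─∣-split = chain-additive ∣_∣ (λ Q P → ∣ Q ─ P ∣) ∣q∣≡∣p∣+∣q─p∣

  dens-congˡ : ∀ {A B C} → A ─ C ≡ B ─ C → dens G A C ≡ dens G B C
  dens-congˡ {C = C} = cong (λ S → frac (incident S C) ∣ S ∣)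

  dens-─ : ∀ A C → dens G (A ─ C) C ≡ dens G A C
  dens-─ A C = dens-congˡ (p─q─q≡p─q A C)

  dens-mono : ∀ {A C A′ C′} → A ─ C ≡ A′ ─ C′ → C ⊆ C′ → dens G A C ℚ.≤ dens G A′ C′
  dens-mono {A} {C} {A′} {C′} eq C⊆C′ = begin
    frac (incident (A ─ C) C) ∣ A ─ C ∣         ≡⟨ cong (λ S → frac (incident S C) ∣ S ∣) eq ⟩
    frac (incident (A′ ─ C′) C) ∣ A′ ─ C′ ∣     ≤⟨ frac-monoˡ-≤ ∣ A′ ─ C′ ∣ (incident-monoʳ (A′ ─ C′) C⊆C′) ⟩
    frac (incident (A′ ─ C′) C′) ∣ A′ ─ C′ ∣    ∎
    where open ℚ.≤-Reasoning

  dens-mediant-< : ∀ {X W Y} → X ⊂ W → W ⊂ Y → dens G Y W ℚ.< dens G W X → dens G Y X ℚ.< dens G W X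
  dens-mediant-< {X} {W} {Y} X⊂W@(X⊆W , _) W⊂Y@(W⊆Y , _) lt =
    subst₂ (λ m k → frac m k ℚ.< dens G W X) (sym (eM-split X⊆W W⊆Y)) (sym (∣─∣-split X⊆W W⊆Y))
      (frac-mediant-< ∣ W ─ X ∣ ∣ Y ─ W ∣ {{∣q─p∣-nonZero X⊂W}} {{∣q─p∣-nonZero W⊂Y}} lt)

  obj-split : ∀ α {T U} → T ⊆ U →
              obj G α U ≡ obj G α T ℚ.+ (fromℕ (eM G U T) ℚ.- α ℚ.* fromℕ ∣ U ─ T ∣)
  obj-split α {T} {U} T⊆U = begin
    fromℕ (eIn G U) ℚ.- α ℚ.* fromℕ ∣ U ∣
      ≡⟨ cong₂ (λ e s → fromℕ e ℚ.- α ℚ.* fromℕ s) (eIn-split T⊆U) (∣q∣≡∣p∣+∣q─p∣ T⊆U) ⟩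
    fromℕ (eIn G T + eM G U T) ℚ.- α ℚ.* fromℕ (∣ T ∣ + ∣ U ─ T ∣)
      ≡⟨ cong₂ (λ e s → e ℚ.- α ℚ.* s) (fromℕ-+ (eIn G T) (eM G U T)) (fromℕ-+ ∣ T ∣ ∣ U ─ T ∣) ⟩
    (fromℕ (eIn G T) ℚ.+ fromℕ (eM G U T)) ℚ.- α ℚ.* (fromℕ ∣ T ∣ ℚ.+ fromℕ ∣ U ─ T ∣)
      ≡⟨ regroup (fromℕ (eIn G T)) (fromℕ (eM G U T)) α (fromℕ ∣ T ∣) (fromℕ ∣ U ─ T ∣) ⟩
    (fromℕ (eIn G T) ℚ.- α ℚ.* fromℕ ∣ T ∣) ℚ.+ (fromℕ (eM G U T) ℚ.- α ℚ.* fromℕ ∣ U ─ T ∣) ∎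
    where
    open ≡-Reasoning
    open +-*-Solver
    regroup : ∀ e m a s k → (e ℚ.+ m) ℚ.- a ℚ.* (s ℚ.+ k) ≡ (e ℚ.- a ℚ.* s) ℚ.+ (m ℚ.- a ℚ.* k)
    regroup = solve 5 (λ e m a s k → (e :+ m) :- a :* (s :+ k) := (e :- a :* s) :+ (m :- a :* k)) refl

  obj-< : ∀ α {T U} → T ⊂ U → dens G U T ℚ.< α → obj G α U ℚ.< obj G α T
  obj-< α {T} {U} T⊂U@(T⊆U , _) lt = subst (ℚ._< obj G α T) (sym (obj-split α T⊆U))
    (p<q⇒r+[p-q]<r (obj G α T) (frac<⇒fromℕ<* α ∣ U ─ T ∣ {{∣q─p∣-nonZero T⊂U}} lt))

  obj-≤ : ∀ α {T U} → T ⊂ U → α ℚ.≤ dens G U T → obj G α T ℚ.≤ obj G α U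
  obj-≤ α {T} {U} T⊂U@(T⊆U , _) le = subst (obj G α T ℚ.≤_) (sym (obj-split α T⊆U))
    (p≤q⇒r≤r+[q-p] (obj G α T) (≤frac⇒*fromℕ≤ α ∣ U ─ T ∣ {{∣q─p∣-nonZero T⊂U}} le))

  -- The maximiser D(α) and locally dense sets

  IsD-exists : ∀ α → ∃ (IsD G α)
  IsD-exists α = Z , (λ U → proj₁ (dominated U)) , (λ U → proj₂ (dominated U))
    where
    key : Subset n → ℚ × ℕ
    key U = obj G α U , ∣ U ∣
    Z : Subset n
    Z = argmax key ⊥ (allSubsets n)
    lex⇒dominated : ∀ {p q a b} → ×-Lex _≡_ ℚ._≤_ _≤_ (p , a) (q , b) → p ℚ.≤ q × (p ≡ q → a ≤ b)
    lex⇒dominated (inj₁ (p≤q , p≢q)) = p≤q , λ p≡q → contradiction p≡q p≢q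
    lex⇒dominated (inj₂ (p≡q , a≤b)) = ℚ.≤-reflexive p≡q , λ _ → a≤b
    dominated : ∀ U → obj G α U ℚ.≤ obj G α Z × (obj G α U ≡ obj G α Z → ∣ U ∣ ≤ ∣ Z ∣)
    dominated U = lex⇒dominated (All.lookup (f[xs]≤f[argmax] {f = key} ⊥ (allSubsets n)) (∈-allSubsets U))

  IsD⇒α≤dens : ∀ {α Z T} → IsD G α Z → T ⊂ Z → α ℚ.≤ dens G Z T
  IsD⇒α≤dens {α} {Z} {T} (maximal , _) T⊂Z =
    ℚ.≮⇒≥ λ lt → ℚ.<-irrefl refl (ℚ.<-≤-trans (obj-< α T⊂Z lt) (maximal T))

  IsD⇒dens<α : ∀ {α Z U} → IsD G α Z → Z ⊂ U → dens G U Z ℚ.< α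
  IsD⇒dens<α {α} {Z} {U} (maximal , largest) Z⊂U = ℚ.≰⇒> λ le →
    ℕ.<⇒≱ (p⊂q⇒∣p∣<∣q∣ Z⊂U) (largest U (ℚ.≤-antisym (maximal U) (obj-≤ α Z⊂U le)))

  IsD⇒LocallyDense : ∀ α {Z} → IsD G α Z → LocallyDense G Z
  IsD⇒LocallyDense α {Z} isD X Y X⊆Z (x , x∈X) (y , y∈Y) Y∩Z≡∅ le =
    ℚ.<-irrefl refl (ℚ.≤-<-trans (ℚ.≤-trans α≤dX le) dY<α)
    where
    Z─X⊂Z : Z ─ X ⊂ Z
    Z─X⊂Z = p─q⊆p Z X , x , X⊆Z x∈X , λ x∈Z─X → x∈p─q⇒x∉q x∈Z─X x∈X
    Z⊂Z∪Y : Z ⊂ Z ∪ Y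
    Z⊂Z∪Y = p⊆p∪q Y , y , q⊆p∪q Z Y y∈Y , Y∩Z≡∅ y∈Y
    α≤dX : α ℚ.≤ dens G X (Z ─ X)
    α≤dX = subst (α ℚ.≤_) (dens-congˡ (trans (p─[p─q]≡q X⊆Z) (sym (p─[q─p]≡p X Z))))
                 (IsD⇒α≤dens isD Z─X⊂Z)
    dY<α : dens G Y Z ℚ.< α
    dY<α = subst (ℚ._< α) (dens-congˡ ([p∪q]─p≡q─p Z Y)) (IsD⇒dens<α isD Z⊂Z∪Y)

  LocallyDense⇒dens-< : ∀ {L W U} → LocallyDense G W → L ⊂ W → W ⊂ U →
                        dens G U W ℚ.< dens G W L
  LocallyDense⇒dens-< {L} {W} {U} ldW L⊂W@(L⊆W , _) W⊂U = ℚ.≰⇒> λ le →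
    ldW (W ─ L) (U ─ W) (p─q⊆p W L) (⊂⇒Nonempty─ L⊂W) (⊂⇒Nonempty─ W⊂U) x∈p─q⇒x∉q
      (subst₂ ℚ._≤_ dW≡ (sym (dens-─ U W)) le)
    where
    dW≡ : dens G W L ≡ dens G (W ─ L) (W ─ (W ─ L))
    dW≡ = trans (sym (dens-─ W L)) (cong (dens G (W ─ L)) (sym (p─[p─q]≡q L⊆W)))

  LocallyDense-⊆-total : ∀ {A B} → LocallyDense G A → LocallyDense G B → A ⊆ B ⊎ B ⊆ A
  LocallyDense-⊆-total {A} {B} ldA ldB with A ⊆? B | B ⊆? A
  ... | yes A⊆B | _       = inj₁ A⊆B
  ... | no  _   | yes B⊆A = inj₂ B⊆A
  ... | no  A⊈B | no  B⊈A = contradiction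
          (climb ldA (⊈⇒∃∉ A⊈B) (⊈⇒∃∉ B⊈A)) (ℚ.<-asym (climb ldB (⊈⇒∃∉ B⊈A) (⊈⇒∃∉ A⊈B)))
    where
    climb : ∀ {P Q} → LocallyDense G P → (∃ λ x → x ∈ P × x ∉ Q) → (∃ λ y → y ∈ Q × y ∉ P) →
            dens G (P ∪ Q) P ℚ.< dens G (Q ∪ P) Q
    climb {P} {Q} ldP (x , x∈P , x∉Q) (y , y∈Q , y∉P) = ℚ.<-≤-trans
      (LocallyDense⇒dens-< ldP (p∩q⊆p P Q , x , x∈P , x∉Q ∘ proj₂ ∘ x∈p∩q⁻ P Q)
                               (p⊆p∪q Q , y , q⊆p∪q P Q y∈Q , y∉P))
      (dens-mono (trans (p─[p∩q]≡p─q P Q) (sym ([p∪q]─p≡q─p Q P))) (p∩q⊆q P Q))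

  ⊥-locallyDense : LocallyDense G ⊥
  ⊥-locallyDense X _ X⊆⊥ (x , x∈X) _ _ _ = ∉⊥ (X⊆⊥ x∈X)

  ⊤-locallyDense : LocallyDense G ⊤
  ⊤-locallyDense _ _ _ _ (y , y∈Y) disjoint _ = disjoint y∈Y ∈⊤

  -- The procedure ExactLD

  dens<alpha : ∀ {X Y} → X ⊂ Y → dens G Y X ℚ.< alpha G X Y
  dens<alpha {X} {Y} (_ , x , _) =
    p<p+1/N (dens G Y X) (n * n) {{ℕ.m*n≢0 n n {{nonZeroIndex x}} {{nonZeroIndex x}}}}

  alpha≤dens : ∀ {X Y V U} → X ⊂ Y → V ⊂ U → dens G Y X ℚ.< dens G U V → alpha G X Y ℚ.≤ dens G U V
  alpha≤dens {X} {Y} {V} {U} X⊂Y V⊂U =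
    frac-gap ∣ Y ─ X ∣ ∣ U ─ V ∣ (n * n) {{∣q─p∣-nonZero X⊂Y}} {{∣q─p∣-nonZero V⊂U}}
      (ℕ.*-mono-≤ (∣p∣≤n (Y ─ X)) (∣p∣≤n (U ─ V)))

  IsD-between : ∀ {X W Y} Z → LocallyDense G X → LocallyDense G W → LocallyDense G Y →
                X ⊂ W → W ⊂ Y → IsD G (alpha G X Y) Z → X ⊂ Z × Z ⊂ Y
  IsD-between {X} {W} {Y} Z ldX ldW ldY X⊂W W⊂Y isD =
    p⊆q∧q⊈p⇒p⊂q X⊆Z Z⊈X , p⊆q∧q⊈p⇒p⊂q Z⊆Y Y⊈Z
    where
    X⊂Y : X ⊂ Y
    X⊂Y = ⊂-trans X⊂W W⊂Y
    ldZ : LocallyDense G Z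
    ldZ = IsD⇒LocallyDense (alpha G X Y) isD

    Y⊈Z : ¬ Y ⊆ Z
    Y⊈Z Y⊆Z with ⊆⇒⊂⊎≡ Y⊆Z
    ... | inj₁ Y⊂Z  = ℚ.<-irrefl refl (ℚ.≤-<-trans (IsD⇒α≤dens isD Y⊂Z)
                        (ℚ.<-trans (LocallyDense⇒dens-< ldY X⊂Y Y⊂Z) (dens<alpha X⊂Y)))
    ... | inj₂ refl = ℚ.<-irrefl refl (ℚ.≤-<-trans (IsD⇒α≤dens isD X⊂Y) (dens<alpha X⊂Y))

    not-above-Z : ∀ {U} → Z ⊂ U → ¬ dens G Y X ℚ.< dens G U Z
    not-above-Z Z⊂U lt = ℚ.<-irrefl refl (ℚ.≤-<-trans (alpha≤dens X⊂Y Z⊂U lt) (IsD⇒dens<α isD Z⊂U))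

    Z⊈X : ¬ Z ⊆ X
    Z⊈X Z⊆X with ⊆⇒⊂⊎≡ Z⊆X
    ... | inj₁ Z⊂X  = not-above-Z Z⊂X (LocallyDense⇒dens-< ldX Z⊂X X⊂Y)
    ... | inj₂ refl = not-above-Z X⊂W (dens-mediant-< X⊂W W⊂Y (LocallyDense⇒dens-< ldW X⊂W W⊂Y))

    X⊆Z : X ⊆ Z
    X⊆Z with LocallyDense-⊆-total ldX ldZ
    ... | inj₁ X⊆Z = X⊆Z
    ... | inj₂ Z⊆X = ⊥-elim (Z⊈X Z⊆X)

    Z⊆Y : Z ⊆ Y
    Z⊆Y with LocallyDense-⊆-total ldZ ldY
    ... | inj₁ Z⊆Y = Z⊆Y
    ... | inj₂ Y⊆Z = ⊥-elim (Y⊈Z Y⊆Z)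

  Output-step : ∀ {X W Y} Z → LocallyDense G X → LocallyDense G W → LocallyDense G Y →
                X ⊂ W → W ⊂ Y → IsD G (alpha G X Y) Z →
                (W ⊂ Z → Output G X Z W) → (Z ⊂ W → Output G Z Y W) → Output G X Y W
  Output-step {X} {W} {Y} Z ldX ldW ldY X⊂W W⊂Y isD below above =
    [ output-below , output-above ]′ (LocallyDense-⊆-total ldW (IsD⇒LocallyDense (alpha G X Y) isD))
    where
    X⊂Y : X ⊂ Y
    X⊂Y = ⊂-trans X⊂W W⊂Y

    Z≢X : Z ≢ X
    Z≢X Z≡X = ⊂-irref (sym Z≡X) (proj₁ (IsD-between Z ldX ldW ldY X⊂W W⊂Y isD))

    output-Z : Output G X Y Z
    output-Z = here ldX ldY X⊂Y isD Z≢X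

    output-below : W ⊆ Z → Output G X Y W
    output-below W⊆Z with ⊆⇒⊂⊎≡ W⊆Z
    ... | inj₁ W⊂Z = left ldX ldY X⊂Y isD Z≢X (below W⊂Z)
    ... | inj₂ W≡Z = subst (Output G X Y) (sym W≡Z) output-Z

    output-above : Z ⊆ W → Output G X Y W
    output-above Z⊆W with ⊆⇒⊂⊎≡ Z⊆W
    ... | inj₁ Z⊂W = right ldX ldY X⊂Y isD Z≢X (above Z⊂W)
    ... | inj₂ Z≡W = subst (Output G X Y) Z≡W output-Z

  ExactLD-visits : ∀ {X Y W} → Acc _<_ (∣ Y ∣ ∸ ∣ X ∣) →
                   LocallyDense G X → LocallyDense G Y → LocallyDense G W →
                   X ⊂ W → W ⊂ Y → Output G X Y W
  ExactLD-visits {X} {Y} {W} (acc smaller) ldX ldY ldW X⊂W W⊂Y = visit (IsD-exists (alpha G X Y))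
    where
    visit : ∃ (IsD G (alpha G X Y)) → Output G X Y W
    visit (Z , isD) = Output-step Z ldX ldW ldY X⊂W W⊂Y isD
      (ExactLD-visits (smaller ∣Z∣∸∣X∣<) ldX ldZ ldW X⊂W)
      (λ Z⊂W → ExactLD-visits (smaller ∣Y∣∸∣Z∣<) ldZ ldY ldW Z⊂W W⊂Y)
      where
      ldZ : LocallyDense G Z
      ldZ = IsD⇒LocallyDense (alpha G X Y) isD
      X⊂Z : X ⊂ Z
      X⊂Z = proj₁ (IsD-between Z ldX ldW ldY X⊂W W⊂Y isD)
      Z⊂Y : Z ⊂ Y
      Z⊂Y = proj₂ (IsD-between Z ldX ldW ldY X⊂W W⊂Y isD)
      ∣Z∣∸∣X∣< : ∣ Z ∣ ∸ ∣ X ∣ < ∣ Y ∣ ∸ ∣ X ∣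
      ∣Z∣∸∣X∣< = ℕ.∸-monoˡ-< (p⊂q⇒∣p∣<∣q∣ Z⊂Y) (p⊆q⇒∣p∣≤∣q∣ (proj₁ X⊂Z))
      ∣Y∣∸∣Z∣< : ∣ Y ∣ ∸ ∣ Z ∣ < ∣ Y ∣ ∸ ∣ X ∣
      ∣Y∣∸∣Z∣< = ℕ.∸-monoʳ-< (p⊂q⇒∣p∣<∣q∣ X⊂Z) (p⊆q⇒∣p∣≤∣q∣ (proj₁ Z⊂Y))

proposition5 : (n : ℕ) (G : Graph n) (W : Subset n) →
               LocallyDense G W → W ≢ ⊥ → W ≢ ⊤ → Output G ⊥ ⊤ W
proposition5 n G W ldW W≢⊥ W≢⊤ =
  ExactLD-visits G (<-wellFounded _) (⊥-locallyDense G) (⊤-locallyDense G) ldW ⊥⊂W W⊂⊤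
  where
  ⊥⊂W : ⊥ ⊂ W
  ⊥⊂W = p⊆q∧q⊈p⇒p⊂q (⊆-min W) (λ W⊆⊥ → W≢⊥ (⊆-antisym W⊆⊥ (⊆-min W)))
  W⊂⊤ : W ⊂ ⊤
  W⊂⊤ = p⊆q∧q⊈p⇒p⊂q ⊆⊤ (λ ⊤⊆W → W≢⊤ (⊆-antisym ⊆⊤ ⊤⊆W))
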